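{- If $P = \begin{bmatrix} 1 & 0 \\ 1 & 1 \end{bmatrix}$, then $sm(m,P) = O(m^{1/2})$.
   Context: A $0$-$1$ matrix $A$ contains a $0$-$1$ matrix $P$ if some submatrix of $A$ (obtained by selecting a subset of rows and a subset of columns, preserving order) either equals $P$ or can be changed into $P$ by turning some ones into zeroes; otherwise $A$ avoids $P$. For $0$-$1$ matrices $A, P$, $LSM(A,P)$ is the maximum number of ones in a $P$-avoiding $0$-$1$ matrix $B$ that is contained in $A$. $sm(m,P)$ is the minimum of $LSM(A,P)$ over all $0$-$1$ matrices $A$ with exactly $m$ ones. -}

module Defs where

open import Data.Nat using (ℕ; _+_; _*_; _≤_)
open import Data.Bool using (Bool; true; false; if_then_else_)
open import Data.Fin using (Fin; zero; suc) renaming (_<_ to _<ᶠ_)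
open import Data.List using (List; map; allFin)
open import Data.Nat.ListAction using (sum)
open import Data.Product using (Σ; _×_)
open import Relation.Binary.PropositionalEquality using (_≡_)
open import Relation.Nullary using (¬_)

-- A 0-1 matrix with r rows and c columns (true = one, false = zero).
Mat : ℕ → ℕ → Set
Mat r c = Fin r → Fin c → Bool

ones : ∀ {r c} → Mat r c → ℕ
ones {r} {c} A = sum (map (λ i → sum (map (λ j → if A i j then 1 else 0) (allFin c))) (allFin r))

StrictMono : ∀ {k n} → (Fin k → Fin n) → Set
StrictMono f = ∀ i j → i <ᶠ j → f i <ᶠ f j

-- A contains P: some submatrix of A (rows/columns chosen in order) has a one
-- wherever P has a one (i.e. it equals P after turning some ones into zeroes).
Contains : ∀ {r c k l} → Mat r c → Mat k l → Set
Contains {r} {c} {k} {l} A P =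
  Σ (Fin k → Fin r) λ f → Σ (Fin l → Fin c) λ g →
    StrictMono f × StrictMono g × (∀ i j → P i j ≡ true → A (f i) (g j) ≡ true)

Avoids : ∀ {r c k l} → Mat r c → Mat k l → Set
Avoids A P = ¬ Contains A P

-- LSM(A,P) ≤ x : every P-avoiding 0-1 matrix B contained in A has at most x ones.
LSM≤ : ∀ {r c k l} → Mat r c → Mat k l → ℕ → Set
LSM≤ A P x = ∀ {k' l'} (B : Mat k' l') → Contains A B → Avoids B P → ones B ≤ x

P₁₂ : Mat 2 2
P₁₂ zero zero = true
P₁₂ zero (suc zero) = false
P₁₂ (suc zero) zero = true
P₁₂ (suc zero) (suc zero) = true

-- A P₁₂-avoiding k × l matrix has at most k + l ones: scanning the rows from the top, a row
-- can share at most one column with the union of the rows above it (two shared columns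
-- j₁ < j₂ would give ones at (i', j₁), (i, j₁), (i, j₂)), so each row after the first adds
-- at most one one beyond the columns it newly occupies.  Every matrix contained in an
-- r × c matrix A is at most r × c, hence LSM(A, P₁₂) ≤ r + c.  Placing m ones
-- into an N × N matrix with N = ⌊√m⌋ + 1 therefore gives LSM ≤ 2N ≤ 4√m.
module Submission where

open import Defs
open import Data.Nat using (ℕ; zero; suc; _+_; _*_; _∸_; _⊓_; _≤_; _<_; _<ᵇ_; z≤n; s≤s; _<?_)
open import Data.Nat.Properties
open import Data.Nat.Solver using (module +-*-Solver)
import Data.Nat.ListAction as List
open import Algebra.Properties.CommutativeMonoid.Sum +-0-commutativeMonoid
  using (sum; sum-syntax; ∑-distrib-+; sum-cong-≗)
open import Data.Bool using (Bool; true; false; if_then_else_; _∨_; _∧_)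
open import Data.Fin using (Fin; zero; suc; toℕ) renaming (_<_ to _<ᶠ_)
import Data.Fin.Properties as Fin
open import Data.List using (map; allFin; tabulate)
open import Data.List.Properties using (map-tabulate)
open import Data.Product using (Σ; ∃-syntax; _×_; _,_)
open import Data.Vec.Functional using ([]; _∷_)
open import Function using (_∘_)
open import Data.Empty using (⊥; ⊥-elim)
open import Relation.Binary using (tri<; tri≈; tri>)
open import Relation.Binary.PropositionalEquality using (_≡_; refl; sym; trans; cong; cong₂; module ≡-Reasoning)
open import Relation.Nullary using (yes; no; contradiction)

indicator : Bool → ℕ
indicator b = if b then 1 else 0

count : ∀ {n} → (Fin n → Bool) → ℕ
count {n} f = ∑[ j < n ] indicator (f j)

sum-map-allFin : ∀ {n} (g : Fin n → ℕ) → List.sum (map g (allFin n)) ≡ sum g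
sum-map-allFin {n} g = trans (cong List.sum (map-tabulate (λ i → i) g)) (sum-tabulate g)
  where
  sum-tabulate : ∀ {n} (g : Fin n → ℕ) → List.sum (tabulate g) ≡ sum g
  sum-tabulate {zero}  g = refl
  sum-tabulate {suc n} g = cong (g zero +_) (sum-tabulate (λ i → g (suc i)))

ones≡∑count : ∀ {r c} (A : Mat r c) → ones A ≡ ∑[ i < r ] count (A i)
ones≡∑count {r} {c} A =
  trans (sum-map-allFin (λ i → List.sum (map (λ j → indicator (A i j)) (allFin c))))
        (sum-cong-≗ (λ i → sum-map-allFin (λ j → indicator (A i j))))

count≤length : ∀ {n} (f : Fin n → Bool) → count f ≤ n
count≤length {zero}  f = z≤n
count≤length {suc n} f with f zero
... | true  = s≤s (count≤length (λ j → f (suc j)))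
... | false = m≤n⇒m≤1+n (count≤length (λ j → f (suc j)))

count≡0 : ∀ {n} (f : Fin n → Bool) → (∀ j → f j ≡ true → ⊥) → count f ≡ 0
count≡0 {zero}  f none = refl
count≡0 {suc n} f none with f zero in eq
... | true  = ⊥-elim (none zero eq)
... | false = count≡0 (λ j → f (suc j)) (λ j → none (suc j))

AtMostOneTrue : ∀ {n} → (Fin n → Bool) → Set
AtMostOneTrue f = ∀ {j₁ j₂} → j₁ <ᶠ j₂ → f j₁ ≡ true → f j₂ ≡ true → ⊥

count≤1 : ∀ {n} (f : Fin n → Bool) → AtMostOneTrue f → count f ≤ 1
count≤1 {zero}  f once = z≤n
count≤1 {suc n} f once with f zero in eq
... | true  = s≤s (≤-reflexive (count≡0 _ (λ j → once {zero} {suc j} (s≤s z≤n) eq)))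
... | false = count≤1 (λ j → f (suc j)) (λ j₁<j₂ → once (s≤s j₁<j₂))

count-+-∨∧ : ∀ {n} (f g : Fin n → Bool) →
  count f + count g ≡ count (λ j → f j ∨ g j) + count (λ j → f j ∧ g j)
count-+-∨∧ {n} f g = begin
  count f + count g                                                   ≡⟨ ∑-distrib-+ (indicator ∘ f) (indicator ∘ g) ⟨
  ∑[ j < n ] (indicator (f j) + indicator (g j))                      ≡⟨ sum-cong-≗ (λ j → pointwise (f j) (g j)) ⟩
  ∑[ j < n ] (indicator (f j ∨ g j) + indicator (f j ∧ g j))          ≡⟨ ∑-distrib-+ (λ j → indicator (f j ∨ g j)) (λ j → indicator (f j ∧ g j)) ⟩
  count (λ j → f j ∨ g j) + count (λ j → f j ∧ g j)                   ∎
  where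
  open ≡-Reasoning
  pointwise : ∀ a b → indicator a + indicator b ≡ indicator (a ∨ b) + indicator (a ∧ b)
  pointwise true  true  = refl
  pointwise true  false = refl
  pointwise false true  = refl
  pointwise false false = refl

P₁₂-free : ∀ {k l} → Mat k l → Set
P₁₂-free M = ∀ {i₁ i₂ j₁ j₂} → i₁ <ᶠ i₂ → j₁ <ᶠ j₂ →
  M i₁ j₁ ≡ true → M i₂ j₁ ≡ true → M i₂ j₂ ≡ true → ⊥

pair-strictMono : ∀ {n} {a b : Fin n} → a <ᶠ b → StrictMono (a ∷ b ∷ [])
pair-strictMono a<b zero       (suc zero) _ = a<b
pair-strictMono a<b zero       zero       ()
pair-strictMono a<b (suc zero) zero       ()
pair-strictMono a<b (suc zero) (suc zero) (s≤s ())

avoids⇒P₁₂-free : ∀ {k l} (M : Mat k l) → Avoids M P₁₂ → P₁₂-free M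
avoids⇒P₁₂-free M avoids {i₁} {i₂} {j₁} {j₂} i₁<i₂ j₁<j₂ e₁₁ e₂₁ e₂₂ =
  avoids (i₁ ∷ i₂ ∷ [] , j₁ ∷ j₂ ∷ [] , pair-strictMono i₁<i₂ , pair-strictMono j₁<j₂ , occurrence)
  where
  occurrence : ∀ a b → P₁₂ a b ≡ true → M ((i₁ ∷ i₂ ∷ []) a) ((j₁ ∷ j₂ ∷ []) b) ≡ true
  occurrence zero       zero       _ = e₁₁
  occurrence zero       (suc zero) ()
  occurrence (suc zero) zero       _ = e₂₁
  occurrence (suc zero) (suc zero) _ = e₂₂

mergeTopRows : ∀ {k l} → Mat (suc (suc k)) l → Mat (suc k) l
mergeTopRows M zero    j = M zero j ∨ M (suc zero) j
mergeTopRows M (suc i) j = M (suc (suc i)) j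

P₁₂-free-mergeTopRows : ∀ {k l} (M : Mat (suc (suc k)) l) → P₁₂-free M → P₁₂-free (mergeTopRows M)
P₁₂-free-mergeTopRows M free {zero} {suc i₂} {j₁} _ j₁<j₂ e₁₁ e₂₁ e₂₂ with M zero j₁ in eq
... | true  = free (s≤s z≤n) j₁<j₂ eq e₂₁ e₂₂
... | false = free (s≤s (s≤s z≤n)) j₁<j₂ e₁₁ e₂₁ e₂₂
P₁₂-free-mergeTopRows M free {suc i₁} {suc i₂} (s≤s i₁<i₂) j₁<j₂ e₁₁ e₂₁ e₂₂ =
  free (s≤s (s≤s i₁<i₂)) j₁<j₂ e₁₁ e₂₁ e₂₂

-- The first two rows of a P₁₂-free matrix share at most one column.
count-topRows≤ : ∀ {k l} (M : Mat (suc (suc k)) l) → P₁₂-free M →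
  count (M zero) + count (M (suc zero)) ≤ suc (count (mergeTopRows M zero))
count-topRows≤ M free = begin
  count r₀ + count r₁                                       ≡⟨ count-+-∨∧ r₀ r₁ ⟩
  count (λ j → r₀ j ∨ r₁ j) + count (λ j → r₀ j ∧ r₁ j)     ≤⟨ +-monoʳ-≤ _ (count≤1 _ shared) ⟩
  count (λ j → r₀ j ∨ r₁ j) + 1                             ≡⟨ +-comm _ 1 ⟩
  suc (count (λ j → r₀ j ∨ r₁ j))                           ∎
  where
  open ≤-Reasoning
  r₀ = M zero
  r₁ = M (suc zero)
  shared : AtMostOneTrue (λ j → r₀ j ∧ r₁ j)
  shared {j₁} {j₂} j₁<j₂ e₁ e₂ with r₀ j₁ in eq₀₁ | r₁ j₁ in eq₁₁ | r₀ j₂ | r₁ j₂ in eq₁₂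
  shared j₁<j₂ refl refl | true | true | true | true = free (s≤s z≤n) j₁<j₂ eq₀₁ eq₁₁ eq₁₂

∑count≤ : ∀ {k l} (M : Mat (suc k) l) → P₁₂-free M → ∑[ i < suc k ] count (M i) ≤ k + l
∑count≤ {zero} M free = ≤-trans (≤-reflexive (+-identityʳ _)) (count≤length (M zero))
∑count≤ {suc k} {l} M free = begin
  count (M zero) + (count (M (suc zero)) + rest)    ≡⟨ +-assoc (count (M zero)) (count (M (suc zero))) rest ⟨
  count (M zero) + count (M (suc zero)) + rest      ≤⟨ +-monoˡ-≤ rest (count-topRows≤ M free) ⟩
  suc (∑[ i < suc k ] count (mergeTopRows M i))     ≤⟨ s≤s (∑count≤ (mergeTopRows M) (P₁₂-free-mergeTopRows M free)) ⟩
  suc (k + l)                                       ∎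
  where
  open ≤-Reasoning
  rest = ∑[ i < k ] count (M (suc (suc i)))

P₁₂-free⇒ones≤ : ∀ {k l} (M : Mat k l) → P₁₂-free M → ones M ≤ k + l
P₁₂-free⇒ones≤ {zero}  M free = z≤n
P₁₂-free⇒ones≤ {suc k} M free =
  ≤-trans (≤-reflexive (ones≡∑count M)) (≤-trans (∑count≤ M free) (n≤1+n _))

strictMono⇒≤ : ∀ {k n} (f : Fin k → Fin n) → StrictMono f → k ≤ n
strictMono⇒≤ f mono = Fin.injective⇒≤ injective
  where
  injective : ∀ {x y} → f x ≡ f y → x ≡ y
  injective {x} {y} fx≡fy with Fin.<-cmp x y
  ... | tri< x<y _ _ = contradiction fx≡fy (Fin.<⇒≢ (mono x y x<y))
  ... | tri≈ _ x≡y _ = x≡y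
  ... | tri> _ _ y<x = contradiction (sym fx≡fy) (Fin.<⇒≢ (mono y x y<x))

LSM≤rows+cols : ∀ {r c} (A : Mat r c) → LSM≤ A P₁₂ (r + c)
LSM≤rows+cols A B (f , g , f-mono , g-mono , _) avoids =
  ≤-trans (P₁₂-free⇒ones≤ B (avoids⇒P₁₂-free B avoids))
          (+-mono-≤ (strictMono⇒≤ f f-mono) (strictMono⇒≤ g g-mono))

rowMajor : ∀ r c → ℕ → Mat r c
rowMajor (suc r) c t zero    j = toℕ j <ᵇ t
rowMajor (suc r) c t (suc i) j = rowMajor r c (t ∸ c) i j

count-<ᵇ : ∀ c t → count {c} (λ j → toℕ j <ᵇ t) ≡ t ⊓ c
count-<ᵇ zero    t       = sym (⊓-zeroʳ t)
count-<ᵇ (suc c) zero    = count≡0 {suc c} (λ j → toℕ j <ᵇ 0) (λ _ ())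
count-<ᵇ (suc c) (suc t) = cong suc (count-<ᵇ c t)

m⊓n+[m∸n]⊓o≡m⊓[n+o] : ∀ m n o → m ⊓ n + (m ∸ n) ⊓ o ≡ m ⊓ (n + o)
m⊓n+[m∸n]⊓o≡m⊓[n+o] m       zero    o = cong (_+ m ⊓ o) (⊓-zeroʳ m)
m⊓n+[m∸n]⊓o≡m⊓[n+o] zero    (suc n) o = refl
m⊓n+[m∸n]⊓o≡m⊓[n+o] (suc m) (suc n) o = cong suc (m⊓n+[m∸n]⊓o≡m⊓[n+o] m n o)

∑count-rowMajor : ∀ r c t → ∑[ i < r ] count (rowMajor r c t i) ≡ t ⊓ (r * c)
∑count-rowMajor zero    c t = sym (⊓-zeroʳ t)
∑count-rowMajor (suc r) c t =
  trans (cong₂ _+_ (count-<ᵇ c t) (∑count-rowMajor r c (t ∸ c))) (m⊓n+[m∸n]⊓o≡m⊓[n+o] t c (r * c))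

ones-rowMajor : ∀ r c t → t ≤ r * c → ones (rowMajor r c t) ≡ t
ones-rowMajor r c t t≤rc =
  trans (ones≡∑count (rowMajor r c t)) (trans (∑count-rowMajor r c t) (m≤n⇒m⊓n≡m t≤rc))

⌊√_⌋ : ∀ m → ∃[ n ] n * n ≤ m × m < suc n * suc n
⌊√ zero ⌋  = 0 , z≤n , s≤s z≤n
⌊√ suc m ⌋ with ⌊√ m ⌋
... | n , n²≤m , m<[1+n]² with suc m <? suc n * suc n
...   | yes 1+m<[1+n]² = n , m≤n⇒m≤1+n n²≤m , 1+m<[1+n]²
...   | no  1+m≮[1+n]² = suc n , ≤-reflexive [1+n]²≡1+m , [1+n]²<[2+n]²
  where
  [1+n]²≡1+m : suc n * suc n ≡ suc m
  [1+n]²≡1+m = ≤-antisym (≮⇒≥ 1+m≮[1+n]²) m<[1+n]²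
  [1+n]²<[2+n]² : suc m < suc (suc n) * suc (suc n)
  [1+n]²<[2+n]² = ≤-trans (≤-reflexive (cong suc (sym [1+n]²≡1+m)))
    (*-mono-< (n<1+n (suc n)) (n<1+n (suc n)))

open +-*-Solver

[n+n]²≡4n² : ∀ n → (n + n) * (n + n) ≡ 4 * (n * n)
[n+n]²≡4n² = solve 1 (λ n → (n :+ n) :* (n :+ n) := con 4 :* (n :* n)) refl

[1+n]²≤4n² : ∀ n → 1 ≤ n → suc n * suc n ≤ 4 * (n * n)
[1+n]²≤4n² n 1≤n = ≤-trans (*-mono-≤ 1+n≤n+n 1+n≤n+n) (≤-reflexive ([n+n]²≡4n² n))
  where
  1+n≤n+n : suc n ≤ n + n
  1+n≤n+n = +-monoˡ-≤ n 1≤n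

mainTheorem12 : Σ ℕ λ C → Σ ℕ λ m₀ → ∀ m → m₀ ≤ m →
    Σ ℕ λ r → Σ ℕ λ c → Σ (Mat r c) λ A →
    (ones A ≡ m) ×
    (∀ {k l} (B : Mat k l) → Contains A B → Avoids B P₁₂ → ones B * ones B ≤ C * m)
mainTheorem12 = 16 , 1 , construction
  where
  construction : ∀ m → 1 ≤ m → Σ ℕ λ r → Σ ℕ λ c → Σ (Mat r c) λ A →
    (ones A ≡ m) ×
    (∀ {k l} (B : Mat k l) → Contains A B → Avoids B P₁₂ → ones B * ones B ≤ 16 * m)
  construction m 1≤m with ⌊√ m ⌋
  ... | zero  , _     , m<1 = contradiction 1≤m (<⇒≱ m<1)
  ... | suc n , n²≤m , m<N² = N , N , A , ones-rowMajor N N m (<⇒≤ m<N²) , bound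
    where
    N = suc (suc n)
    A = rowMajor N N m
    bound : ∀ {k l} (B : Mat k l) → Contains A B → Avoids B P₁₂ → ones B * ones B ≤ 16 * m
    bound B A⊇B avoids = begin
      ones B * ones B                   ≤⟨ *-mono-≤ onesB≤2N onesB≤2N ⟩
      (N + N) * (N + N)                 ≡⟨ [n+n]²≡4n² N ⟩
      4 * (N * N)                       ≤⟨ *-monoʳ-≤ 4 ([1+n]²≤4n² (suc n) (s≤s z≤n)) ⟩
      4 * (4 * (suc n * suc n))         ≤⟨ *-monoʳ-≤ 4 (*-monoʳ-≤ 4 n²≤m) ⟩
      4 * (4 * m)                       ≡⟨ *-assoc 4 4 m ⟨
      16 * m                            ∎
      where
      open ≤-Reasoning
      onesB≤2N = LSM≤rows+cols A B A⊇B avoids
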